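{- Let $d_0\in\{ -1,2\}$, let $p\equiv1\pmod 8$ be a prime and let $w\in\mathbb{Z}[\sqrt{d_0}]$ satisfy $\mathrm{N}(w)=p$. Then for every $z\in\mathbb{Z}[\sqrt{d_0}]$, $$\gamma(w,z)\gamma(\bar w,z)=\left(\frac{\mathrm{N}(z)}{p}\right),$$ where the right-hand side is a Legendre symbol.
   Context: Bar denotes the nontrivial automorphism of $\mathbb{Q}(\sqrt{d_0})$ and $\mathrm{N}$ the norm. For a prime ideal $\mathfrak p\nmid 2$ and $a\in\mathbb{Z}[\sqrt{d_0}]$, $\left(\frac{a}{\mathfrak p}\right)$ is $0$ if $a\in\mathfrak p$, else $\pm1$ according as $a$ is or is not a square mod $\mathfrak p$; extended multiplicatively to odd ideals. For odd $w$ (i.e. $\mathrm{N}(w)$ odd), $\gamma(w,z)=\left(\frac{\bar w\bar z}{(w)}\right)$. -}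

module Defs where

open import Data.Nat using (ℕ)
open import Data.Integer using (ℤ; +_; -_; _+_; _-_; _*_)
import Data.Integer.Divisibility as ℤDiv
open import Data.Product using (Σ; ∃; _×_)
open import Data.Sum using (_⊎_)
open import Relation.Nullary using (¬_)
open import Relation.Binary.PropositionalEquality using (_≡_)

record ℤ√ (d : ℤ) : Set where
  constructor _+_√
  field
    re : ℤ
    im : ℤ
open ℤ√ public

module _ {d : ℤ} where

  _⊕_ : ℤ√ d → ℤ√ d → ℤ√ d
  x ⊕ y = (re x + re y) + (im x + im y) √

  _⊖_ : ℤ√ d → ℤ√ d → ℤ√ d
  x ⊖ y = (re x - re y) + (im x - im y) √

  _⊗_ : ℤ√ d → ℤ√ d → ℤ√ d
  x ⊗ y = (re x * re y + d * (im x * im y)) + (re x * im y + im x * re y) √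

  conj : ℤ√ d → ℤ√ d
  conj x = re x + (- im x) √

  N : ℤ√ d → ℤ
  N x = re x * re x - d * (im x * im x)

  _∣√_ : ℤ√ d → ℤ√ d → Set
  w ∣√ a = ∃ λ q → w ⊗ q ≡ a

  SquareMod√ : ℤ√ d → ℤ√ d → Set
  SquareMod√ w a = ∃ λ x → w ∣√ ((x ⊗ x) ⊖ a)

  -- QRSym w a e : "the quadratic residue symbol (a / (w)) equals e",
  -- for (w) a prime ideal: 0 if a ∈ (w); 1 if a ∉ (w) and a is a square mod (w);
  -- -1 if a ∉ (w) and a is not a square mod (w).
  QRSym : ℤ√ d → ℤ√ d → ℤ → Set
  QRSym w a e =
      (e ≡ + 0 × w ∣√ a)
    ⊎ (e ≡ + 1 × ¬ (w ∣√ a) × SquareMod√ w a)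
    ⊎ (e ≡ - (+ 1) × ¬ (w ∣√ a) × ¬ SquareMod√ w a)

  Gamma : ℤ√ d → ℤ√ d → ℤ → Set
  Gamma w z e = QRSym w (conj w ⊗ conj z) e

SquareModℤ : ℕ → ℤ → Set
SquareModℤ p n = ∃ λ (x : ℤ) → (+ p) ℤDiv.∣ (x * x - n)

Legendre : ℤ → ℕ → ℤ → Set
Legendre n p e =
    (e ≡ + 0 × (+ p) ℤDiv.∣ n)
  ⊎ (e ≡ + 1 × ¬ ((+ p) ℤDiv.∣ n) × SquareModℤ p n)
  ⊎ (e ≡ - (+ 1) × ¬ ((+ p) ℤDiv.∣ n) × ¬ SquareModℤ p n)

module Submission where

-- Let w = a + b√d₀ with N(w) = p.  Since p ∤ b, the class
-- t ≡ -a/b (mod p) is a square root of d₀, and reduction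
--     φ : ℤ[√d₀] → ℤ/p,   x + y√d₀ ↦ x + y t
-- is a ring homomorphism with kernel (w).  Hence the residue symbol
-- modulo the prime ideal (w) is the Legendre symbol of the reduction:
-- (α/(w)) = (φα/p).  For w̄ the root is -t, and one finds with
-- W = φ(w̄), Z = φ(z), Z̄ = φ(z̄)
--     γ(w,z) = (W Z̄ / p),  γ(w̄,z) = (W Z / p),  N(z) ≡ Z Z̄ (mod p).
-- As W ≡ 2a is prime to p, multiplicativity of the Legendre symbol
-- gives γ(w,z) γ(w̄,z) = (W² Z Z̄ / p) = (N(z)/p).

open import Defs
open import Data.Nat as ℕ using (ℕ; zero; suc; _%_)
import Data.Nat.Properties as ℕP
import Data.Nat.Divisibility as ℕD
import Data.Nat.DivMod as ℕDM
import Data.Nat.Tactic.RingSolver as ℕSolver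
open import Data.Nat.Primality
  using (Prime; euclidsLemma; prime⇒irreducible; prime⇒nonZero; prime⇒nonTrivial; ¬prime[1])
open import Data.Nat.Coprimality using (Coprime; coprime-Bézout)
open import Data.Nat.GCD using (module Bézout)
open import Data.Fin as F using (Fin; toℕ; fromℕ<; remQuot; combine)
import Data.Fin.Properties as FP
open import Data.Integer using (ℤ; +_; -_; _*_; _+_; _-_; -[1+_]; ∣_∣)
import Data.Integer.Properties as ℤP
open import Data.Integer.DivMod using (_%ℕ_; _/ℕ_; n%ℕd<d; a≡a%ℕn+[a/ℕn]*n)
import Data.Integer.Divisibility.Signed as S
open S using (divides)
open import Data.Integer.Tactic.RingSolver using (solve; solve-∀)
open import Data.List using (_∷_; [])
open import Data.Product using (∃; _×_; _,_; uncurry)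
open import Data.Sum as Sum using (_⊎_; inj₁; inj₂; [_,_]; [_,_]′)
open import Data.Empty using (⊥; ⊥-elim)
open import Function using (_∘_; id)
open import Relation.Nullary using (¬_; yes; no)
open import Relation.Binary.Bundles using (Setoid)
import Relation.Binary.Reasoning.Setoid as SetoidReasoning
open import Relation.Binary.PropositionalEquality
  using (_≡_; _≢_; refl; sym; trans; cong; cong₂; subst; subst₂; module ≡-Reasoning)

-- Arithmetic modulo a prime p.
module Congruence (p : ℕ) (p-prime : Prime p) where

  -- needed by division with remainder and cancellation by p
  instance
    p-nonZero : ℕ.NonZero p
    p-nonZero = prime⇒nonZero p-prime

  infix 4 p∣_ _≈_

  p∣_ : ℤ → Set
  p∣ a = + p S.∣ a

  -- Congruence modulo p; a record, so that both sides can be inferred.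
  record _≈_ (a b : ℤ) : Set where
    constructor mk≈
    field p∣difference : p∣ (a - b)
  open _≈_ public

  ≈-refl : ∀ {a} → a ≈ a
  ≈-refl {a} = mk≈ (divides (+ 0) (ℤP.+-inverseʳ a))

  ≡⇒≈ : ∀ {a b} → a ≡ b → a ≈ b
  ≡⇒≈ refl = ≈-refl

  ≈-sym : ∀ {a b} → a ≈ b → b ≈ a
  ≈-sym {a} {b} (mk≈ h) = mk≈ (subst p∣_ negated (S.∣m⇒∣-m h))
    where
    negated : - (a - b) ≡ b - a
    negated = solve (a ∷ b ∷ [])

  ≈-trans : ∀ {a b c} → a ≈ b → b ≈ c → a ≈ c
  ≈-trans {a} {b} {c} (mk≈ h) (mk≈ k) =
    mk≈ (subst p∣_ (ℤP.+-minus-telescope a b c) (S.∣m∣n⇒∣m+n h k))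

  ≈-setoid : Setoid _ _
  ≈-setoid = record
    { Carrier = ℤ ; _≈_ = _≈_
    ; isEquivalence = record { refl = ≈-refl ; sym = ≈-sym ; trans = ≈-trans } }

  module ≈-Reasoning = SetoidReasoning ≈-setoid

  +-cong : ∀ {a b c d} → a ≈ b → c ≈ d → a + c ≈ b + d
  +-cong {a} {b} {c} {d} (mk≈ h) (mk≈ k) = mk≈ (subst p∣_ regroup (S.∣m∣n⇒∣m+n h k))
    where
    regroup : (a - b) + (c - d) ≡ (a + c) - (b + d)
    regroup = solve (a ∷ b ∷ c ∷ d ∷ [])

  *-cong : ∀ {a b c d} → a ≈ b → c ≈ d → a * c ≈ b * d
  *-cong {a} {b} {c} {d} (mk≈ h) (mk≈ k) =
    mk≈ (subst p∣_ regroup (S.∣m∣n⇒∣m+n (S.∣m⇒∣m*n c h) (S.∣n⇒∣m*n b k)))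
    where
    regroup : (a - b) * c + b * (c - d) ≡ a * c - b * d
    regroup = solve (a ∷ b ∷ c ∷ d ∷ [])

  neg-cong : ∀ {a b} → a ≈ b → - a ≈ - b
  neg-cong {a} {b} (mk≈ h) = mk≈ (subst p∣_ regroup (S.∣m⇒∣-m h))
    where
    regroup : - (a - b) ≡ - a - - b
    regroup = solve (a ∷ b ∷ [])

  p∣⇒≈0 : ∀ {a} → p∣ a → a ≈ + 0
  p∣⇒≈0 {a} h = mk≈ (subst p∣_ (sym (ℤP.+-identityʳ a)) h)

  ≈0⇒p∣ : ∀ {a} → a ≈ + 0 → p∣ a
  ≈0⇒p∣ {a} (mk≈ h) = subst p∣_ (ℤP.+-identityʳ a) h

  p∣-resp-≈ : ∀ {a b} → a ≈ b → p∣ a → p∣ b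
  p∣-resp-≈ a≈b h = ≈0⇒p∣ (≈-trans (≈-sym a≈b) (p∣⇒≈0 h))

  ¬p∣-resp-≈ : ∀ {a b} → a ≈ b → ¬ p∣ a → ¬ p∣ b
  ¬p∣-resp-≈ a≈b ¬h h = ¬h (p∣-resp-≈ (≈-sym a≈b) h)

  +-multiple : ∀ a k → a + k * + p ≈ a
  +-multiple a k = mk≈ (divides k (cancel a (k * + p)))
    where
    cancel : ∀ x y → x + y - x ≡ y
    cancel = solve-∀

  euclid : ∀ a b → p∣ (a * b) → p∣ a ⊎ p∣ b
  euclid a b h = Sum.map S.∣ᵤ⇒∣ S.∣ᵤ⇒∣
    (euclidsLemma ∣ a ∣ ∣ b ∣ p-prime (subst (p ℕD.∣_) (ℤP.abs-* a b) (S.∣⇒∣ᵤ h)))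

  ¬p∣-* : ∀ {a b} → ¬ p∣ a → ¬ p∣ b → ¬ p∣ (a * b)
  ¬p∣-* ¬p∣a ¬p∣b h = [ ¬p∣a , ¬p∣b ] (euclid _ _ h)

  *-cancelˡ-≈ : ∀ {c a b} → ¬ p∣ c → c * a ≈ c * b → a ≈ b
  *-cancelˡ-≈ {c} {a} {b} ¬p∣c (mk≈ h) =
    [ ⊥-elim ∘ ¬p∣c , mk≈ {a} {b} ] (euclid c (a - b) (subst p∣_ factor h))
    where
    factor : c * a - c * b ≡ c * (a - b)
    factor = solve (c ∷ a ∷ b ∷ [])

  ¬p∣⇒coprime : ∀ {m} → ¬ p∣ + m → Coprime m p
  ¬p∣⇒coprime ¬p∣m (i∣m , i∣p) with prime⇒irreducible p-prime i∣p
  ... | inj₁ i≡1  = i≡1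
  ... | inj₂ refl = ⊥-elim (¬p∣m (S.∣ᵤ⇒∣ i∣m))

  private
    pos-linear : ∀ n a b c e → n ℕ.+ a ℕ.* b ≡ c ℕ.* e → + n + + a * + b ≡ + c * + e
    pos-linear n a b c e eq = begin
      + n + + a * + b    ≡⟨ cong (_+_ (+ n)) (ℤP.pos-* a b) ⟨
      + n + + (a ℕ.* b)  ≡⟨ ℤP.pos-+ n (a ℕ.* b) ⟨
      + (n ℕ.+ a ℕ.* b)  ≡⟨ cong +_ eq ⟩
      + (c ℕ.* e)        ≡⟨ ℤP.pos-* c e ⟩
      + c * + e          ∎
      where open ≡-Reasoning

    natural-inverse : ∀ m → ¬ p∣ + m → ∃ λ u → + m * u ≈ + 1
    natural-inverse m ¬p∣m with coprime-Bézout (¬p∣⇒coprime ¬p∣m)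
    ... | Bézout.+- x y eq = + x , (begin
          + m * + x        ≡⟨ ℤP.*-comm (+ m) (+ x) ⟩
          + x * + m        ≡⟨ pos-linear 1 y p x m eq ⟨
          + 1 + + y * + p  ≈⟨ +-multiple (+ 1) (+ y) ⟩
          + 1              ∎)
      where open ≈-Reasoning
    ... | Bézout.-+ x y eq = - + x , (begin
          + m * - + x              ≡⟨ flip-sign (+ m) (+ x) ⟩
          + 1 - (+ 1 + + x * + m)  ≡⟨ cong (_-_ (+ 1)) (pos-linear 1 x m y p eq) ⟩
          + 1 - + y * + p          ≡⟨ cong (_+_ (+ 1)) (ℤP.neg-distribˡ-* (+ y) (+ p)) ⟩
          + 1 + (- + y) * + p      ≈⟨ +-multiple (+ 1) (- + y) ⟩
          + 1                      ∎)
      where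
      open ≈-Reasoning
      flip-sign : ∀ u v → u * - v ≡ + 1 - (+ 1 + v * u)
      flip-sign = solve-∀

  inverse : ∀ c → ¬ p∣ c → ∃ λ u → c * u ≈ + 1
  inverse (+ m)    ¬p∣c = natural-inverse m ¬p∣c
  inverse -[1+ n ] ¬p∣c with natural-inverse (suc n) (¬p∣c ∘ S.∣m⇒∣-m)
  ... | u , nu≈1 = - u , (begin
        -[1+ n ] * - u  ≡⟨ signs-cancel (+ suc n) u ⟩
        + suc n * u     ≈⟨ nu≈1 ⟩
        + 1             ∎)
    where
    open ≈-Reasoning
    signs-cancel : ∀ c u → (- c) * (- u) ≡ c * u
    signs-cancel = solve-∀

  solve-linear : ∀ {b} → ¬ p∣ b → ∀ c → ∃ λ t → b * t ≈ c
  solve-linear {b} ¬p∣b c with inverse b ¬p∣b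
  ... | u , bu≈1 = u * c , (begin
        b * (u * c)  ≡⟨ ℤP.*-assoc b u c ⟨
        b * u * c    ≈⟨ *-cong bu≈1 (≈-refl {c}) ⟩
        + 1 * c      ≡⟨ ℤP.*-identityˡ c ⟩
        c            ∎)
    where open ≈-Reasoning

  p∣-small⇒≡0 : ∀ {a} → ∣ a ∣ ℕ.< p → p∣ a → a ≡ + 0
  p∣-small⇒≡0 lt h = ℤP.∣i∣≡0⇒i≡0 (multiple-below lt (S.∣⇒∣ᵤ h))
    where
    multiple-below : ∀ {n} → n ℕ.< p → p ℕD.∣ n → n ≡ 0
    multiple-below {zero}  _  _   = refl
    multiple-below {suc _} lt p∣n = ⊥-elim (ℕD.>⇒∤ lt p∣n)

  ¬p∣-small : ∀ n → suc n ℕ.< p → ¬ p∣ + suc n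
  ¬p∣-small n lt h with p∣-small⇒≡0 lt h
  ... | ()

  ¬p∣1 : ¬ p∣ + 1
  ¬p∣1 = ¬p∣-small 0 (ℕ.nonTrivial⇒n>1 p {{prime⇒nonTrivial p-prime}})

  residue : ℤ → Fin p
  residue a = fromℕ< (n%ℕd<d a p)

  ≈-remainder : ∀ a → a ≈ + (a %ℕ p)
  ≈-remainder a =
    subst (_≈ + (a %ℕ p)) (sym (a≡a%ℕn+[a/ℕn]*n a p)) (+-multiple (+ (a %ℕ p)) (a /ℕ p))

  residue-≡⇒≈ : ∀ a b → residue a ≡ residue b → a ≈ b
  residue-≡⇒≈ a b eq = begin
    a            ≈⟨ ≈-remainder a ⟩
    + (a %ℕ p)   ≡⟨ cong +_ same-remainder ⟩
    + (b %ℕ p)   ≈⟨ ≈-sym (≈-remainder b) ⟩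
    b            ∎
    where
    open ≈-Reasoning
    same-remainder : a %ℕ p ≡ b %ℕ p
    same-remainder = trans (sym (FP.toℕ-fromℕ< _)) (trans (cong toℕ eq) (FP.toℕ-fromℕ< _))

-- Squares modulo p.
module Squares (p : ℕ) (p-prime : Prime p) where
  open Congruence p p-prime

  IsSquare : ℤ → Set
  IsSquare a = ∃ λ x → x * x ≈ a

  IsSquare-resp-≈ : ∀ {a b} → a ≈ b → IsSquare a → IsSquare b
  IsSquare-resp-≈ a≈b (x , x²≈a) = x , ≈-trans x²≈a a≈b

  p∣⇒IsSquare : ∀ {a} → p∣ a → IsSquare a
  p∣⇒IsSquare h = + 0 , ≈-sym (p∣⇒≈0 h)

  IsSquare-* : ∀ {a b} → IsSquare a → IsSquare b → IsSquare (a * b)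
  IsSquare-* {a} {b} (x , x²≈a) (y , y²≈b) = x * y , (begin
    x * y * (x * y)  ≡⟨ solve (x ∷ y ∷ []) ⟩
    x * x * (y * y)  ≈⟨ *-cong x²≈a y²≈b ⟩
    a * b            ∎)
    where open ≈-Reasoning

  ¬p∣-root : ∀ {s a} → s * s ≈ a → ¬ p∣ a → ¬ p∣ s
  ¬p∣-root {s} s²≈a ¬p∣a p∣s = ¬p∣a (p∣-resp-≈ s²≈a (S.∣m⇒∣m*n s p∣s))

  IsSquare-cancel : ∀ {a b} → IsSquare a → ¬ p∣ a → IsSquare (a * b) → IsSquare b
  IsSquare-cancel {a} {b} (s , s²≈a) ¬p∣a (c , c²≈ab) with inverse s (¬p∣-root s²≈a ¬p∣a)
  ... | u , su≈1 = c * u , (begin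
      c * u * (c * u)      ≡⟨ solve (c ∷ u ∷ []) ⟩
      c * c * (u * u)      ≈⟨ *-cong c²≈ab ≈-refl ⟩
      a * b * (u * u)      ≈⟨ *-cong (*-cong (≈-sym s²≈a) ≈-refl) ≈-refl ⟩
      s * s * b * (u * u)  ≡⟨ solve (s ∷ b ∷ u ∷ []) ⟩
      s * u * (s * u) * b  ≈⟨ *-cong (*-cong su≈1 su≈1) ≈-refl ⟩
      + 1 * + 1 * b        ≡⟨ ℤP.*-identityˡ b ⟩
      b                    ∎)
    where open ≈-Reasoning

  IsSquare-ratio : ∀ α β X Y → ¬ p∣ Y → α * (X * X) ≈ β * (Y * Y) → IsSquare (α * β)
  IsSquare-ratio α β X Y ¬p∣Y eq with inverse Y ¬p∣Y
  ... | u , Yu≈1 = α * X * u , (begin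
      α * X * u * (α * X * u)      ≡⟨ solve (α ∷ X ∷ u ∷ []) ⟩
      α * (α * (X * X)) * (u * u)  ≈⟨ *-cong (*-cong (≈-refl {α}) eq) (≈-refl {u * u}) ⟩
      α * (β * (Y * Y)) * (u * u)  ≡⟨ solve (α ∷ β ∷ Y ∷ u ∷ []) ⟩
      α * β * (Y * u * (Y * u))    ≈⟨ *-cong (≈-refl {α * β}) (*-cong Yu≈1 Yu≈1) ⟩
      α * β * (+ 1 * + 1)          ≡⟨ ℤP.*-identityʳ (α * β) ⟩
      α * β                        ∎)
    where open ≈-Reasoning

  square-roots : ∀ a b → a * a ≈ b * b → p∣ (a - b) ⊎ p∣ (a + b)
  square-roots a b (mk≈ h) = euclid (a - b) (a + b) (subst p∣_ factor h)
    where
    factor : a * a - b * b ≡ (a - b) * (a + b)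
    factor = solve (a ∷ b ∷ [])

-- The Legendre symbol modulo p, as a relation between n and its value.
module LegendreSymbol (p : ℕ) (p-prime : Prime p) where
  open Congruence p p-prime
  open Squares p p-prime

  Symbol : ℤ → ℤ → Set
  Symbol n e =
      (e ≡ + 0 × p∣ n)
    ⊎ (e ≡ + 1 × ¬ p∣ n × IsSquare n)
    ⊎ (e ≡ - + 1 × ¬ p∣ n × ¬ IsSquare n)

  Legendre⇒Symbol : ∀ {n e} → Legendre n p e → Symbol n e
  Legendre⇒Symbol (inj₁ (e≡0 , p∣n)) = inj₁ (e≡0 , S.∣ᵤ⇒∣ p∣n)
  Legendre⇒Symbol (inj₂ (inj₁ (e≡1 , ¬p∣n , (x , p∣x²-n)))) =
    inj₂ (inj₁ (e≡1 , ¬p∣n ∘ S.∣⇒∣ᵤ , x , mk≈ (S.∣ᵤ⇒∣ p∣x²-n)))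
  Legendre⇒Symbol (inj₂ (inj₂ (e≡-1 , ¬p∣n , ¬sq))) =
    inj₂ (inj₂ (e≡-1 , ¬p∣n ∘ S.∣⇒∣ᵤ , λ { (x , mk≈ h) → ¬sq (x , S.∣⇒∣ᵤ h) }))

  Symbol-resp-≈ : ∀ {a b e} → a ≈ b → Symbol a e → Symbol b e
  Symbol-resp-≈ a≈b (inj₁ (e≡0 , p∣a)) = inj₁ (e≡0 , p∣-resp-≈ a≈b p∣a)
  Symbol-resp-≈ a≈b (inj₂ (inj₁ (e≡1 , ¬p∣a , sq))) =
    inj₂ (inj₁ (e≡1 , ¬p∣-resp-≈ a≈b ¬p∣a , IsSquare-resp-≈ a≈b sq))
  Symbol-resp-≈ a≈b (inj₂ (inj₂ (e≡-1 , ¬p∣a , ¬sq))) =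
    inj₂ (inj₂ (e≡-1 , ¬p∣-resp-≈ a≈b ¬p∣a , ¬sq ∘ IsSquare-resp-≈ (≈-sym a≈b)))

  symbol-zero : ∀ {n e} → p∣ n → Symbol n e → e ≡ + 0
  symbol-zero _   (inj₁ (e≡0 , _))              = e≡0
  symbol-zero p∣n (inj₂ (inj₁ (_ , ¬p∣n , _)))  = ⊥-elim (¬p∣n p∣n)
  symbol-zero p∣n (inj₂ (inj₂ (_ , ¬p∣n , _)))  = ⊥-elim (¬p∣n p∣n)

  symbol-one : ∀ {n e} → ¬ p∣ n → ¬ ¬ IsSquare n → Symbol n e → e ≡ + 1
  symbol-one ¬p∣n _    (inj₁ (_ , p∣n))          = ⊥-elim (¬p∣n p∣n)
  symbol-one _    _    (inj₂ (inj₁ (e≡1 , _)))    = e≡1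
  symbol-one _    ¬¬sq (inj₂ (inj₂ (_ , _ , ¬sq))) = ⊥-elim (¬¬sq ¬sq)

  symbol-minus-one : ∀ {n e} → ¬ IsSquare n → Symbol n e → e ≡ - + 1
  symbol-minus-one ¬sq (inj₁ (_ , p∣n))          = ⊥-elim (¬sq (p∣⇒IsSquare p∣n))
  symbol-minus-one ¬sq (inj₂ (inj₁ (_ , _ , sq))) = ⊥-elim (¬sq sq)
  symbol-minus-one _   (inj₂ (inj₂ (e≡-1 , _)))   = e≡-1

  Symbol-square-factor : ∀ {W n e} → ¬ p∣ W → Symbol n e → Symbol (W * W * n) e
  Symbol-square-factor {W} _ (inj₁ (e≡0 , p∣n)) = inj₁ (e≡0 , S.∣n⇒∣m*n (W * W) p∣n)
  Symbol-square-factor {W} ¬p∣W (inj₂ (inj₁ (e≡1 , ¬p∣n , sq))) =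
    inj₂ (inj₁ (e≡1 , ¬p∣-* (¬p∣-* ¬p∣W ¬p∣W) ¬p∣n , IsSquare-* (W , ≈-refl) sq))
  Symbol-square-factor {W} ¬p∣W (inj₂ (inj₂ (e≡-1 , ¬p∣n , ¬sq))) =
    inj₂ (inj₂ (e≡-1 , ¬p∣-* (¬p∣-* ¬p∣W ¬p∣W) ¬p∣n ,
                ¬sq ∘ IsSquare-cancel (W , ≈-refl) (¬p∣-* ¬p∣W ¬p∣W)))

-- Primes p = 2k + 1 with k ≥ 2: multiplicativity of the Legendre symbol.
module OddPrime (p : ℕ) (p-prime : Prime p) (k : ℕ) (p≡2k+1 : p ≡ suc (k ℕ.+ k)) (2≤k : 2 ℕ.≤ k) where
  open Congruence p p-prime
  open Squares p p-prime
  open LegendreSymbol p p-prime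

  ¬p∣2 : ¬ p∣ + 2
  ¬p∣2 = ¬p∣-small 1 (subst (2 ℕ.<_) (sym p≡2k+1) (ℕ.s≤s (ℕP.≤-trans 2≤k (ℕP.m≤m+n k k))))

  point : Fin k → ℤ
  point x = + suc (toℕ x)

  sum-of-points<p : (x y : Fin k) → suc (toℕ x) ℕ.+ suc (toℕ y) ℕ.< p
  sum-of-points<p x y =
    subst (_ ℕ.<_) (sym p≡2k+1) (ℕ.s≤s (ℕP.+-mono-≤ (FP.toℕ<n x) (FP.toℕ<n y)))

  ¬p∣point : ∀ x → ¬ p∣ point x
  ¬p∣point x = ¬p∣-small (toℕ x) (ℕP.≤-<-trans (ℕP.m≤m+n _ _) (sum-of-points<p x x))

  -- The squares of 1, …, k are pairwise incongruent, since x ± y ≢ 0 (mod p).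
  squares-distinct : (x y : Fin k) → point x * point x ≈ point y * point y → x ≡ y
  squares-distinct x y sq = [ equal , ⊥-elim ∘ ¬p∣sum ] (square-roots (point x) (point y) sq)
    where
    equal : p∣ (point x - point y) → x ≡ y
    equal p∣difference = FP.toℕ-injective (ℕP.suc-injective (ℤP.+-injective
      (ℤP.i-j≡0⇒i≡j _ _ (p∣-small⇒≡0 difference<p p∣difference))))
      where
      difference<p : ∣ point x - point y ∣ ℕ.< p
      difference<p = ℕP.≤-<-trans (ℤP.∣i-j∣≤∣i∣+∣j∣ (point x) (point y)) (sum-of-points<p x y)
    ¬p∣sum : ¬ p∣ (point x + point y)
    ¬p∣sum = ¬p∣-small _ (sum-of-points<p x y)
           ∘ subst p∣_ (sym (ℤP.pos-+ (suc (toℕ x)) (suc (toℕ y))))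

  -- Room for the pigeonhole principle below (uses k ≥ 2).
  p<3k : p ℕ.< 3 ℕ.* k
  p<3k = subst₂ ℕ._<_ (sym p≡2k+1) three-k (ℕP.+-monoˡ-≤ (k ℕ.+ k) 2≤k)
    where
    three-k : k ℕ.+ (k ℕ.+ k) ≡ 3 ℕ.* k
    three-k = cong (λ m → k ℕ.+ (k ℕ.+ m)) (sym (ℕP.+-identityʳ k))

  -- Among the 3k > p numbers c·x² (c ∈ {1, A, B}, 1 ≤ x ≤ k) two are
  -- congruent.  For equal coefficients this contradicts squares-distinct;
  -- for different ones it makes A, B or AB a square.
  private
    module Collision {A B : ℤ} (¬p∣A : ¬ p∣ A) (¬p∣B : ¬ p∣ B)
      (¬sqA : ¬ IsSquare A) (¬sqB : ¬ IsSquare B) (¬sqAB : ¬ IsSquare (A * B)) where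

      coefficient : Fin 3 → ℤ
      coefficient F.zero                 = + 1
      coefficient (F.suc F.zero)         = A
      coefficient (F.suc (F.suc F.zero)) = B

      ¬p∣coefficient : ∀ c → ¬ p∣ coefficient c
      ¬p∣coefficient F.zero                 = ¬p∣1
      ¬p∣coefficient (F.suc F.zero)         = ¬p∣A
      ¬p∣coefficient (F.suc (F.suc F.zero)) = ¬p∣B

      ¬square-product : ∀ c c′ → c ≢ c′ → ¬ IsSquare (coefficient c * coefficient c′)
      ¬square-product F.zero                 F.zero                 c≢c′ = ⊥-elim (c≢c′ refl)
      ¬square-product F.zero                 (F.suc F.zero)         _    =
        ¬sqA ∘ IsSquare-resp-≈ (≡⇒≈ (ℤP.*-identityˡ A))
      ¬square-product F.zero                 (F.suc (F.suc F.zero)) _    =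
        ¬sqB ∘ IsSquare-resp-≈ (≡⇒≈ (ℤP.*-identityˡ B))
      ¬square-product (F.suc F.zero)         F.zero                 _    =
        ¬sqA ∘ IsSquare-resp-≈ (≡⇒≈ (ℤP.*-identityʳ A))
      ¬square-product (F.suc F.zero)         (F.suc F.zero)         c≢c′ = ⊥-elim (c≢c′ refl)
      ¬square-product (F.suc F.zero)         (F.suc (F.suc F.zero)) _    = ¬sqAB
      ¬square-product (F.suc (F.suc F.zero)) F.zero                 _    =
        ¬sqB ∘ IsSquare-resp-≈ (≡⇒≈ (ℤP.*-identityʳ B))
      ¬square-product (F.suc (F.suc F.zero)) (F.suc F.zero)         _    =
        ¬sqAB ∘ IsSquare-resp-≈ (≡⇒≈ (ℤP.*-comm B A))
      ¬square-product (F.suc (F.suc F.zero)) (F.suc (F.suc F.zero)) c≢c′ = ⊥-elim (c≢c′ refl)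

      value : Fin 3 × Fin k → ℤ
      value (c , x) = coefficient c * (point x * point x)

      value-injective : ∀ u v → value u ≈ value v → u ≡ v
      value-injective (c , x) (c′ , y) eq with c FP.≟ c′
      ... | yes refl = cong (c ,_) (squares-distinct x y (*-cancelˡ-≈ (¬p∣coefficient c) eq))
      ... | no c≢c′  = ⊥-elim (¬square-product c c′ c≢c′
                         (IsSquare-ratio (coefficient c) (coefficient c′) (point x) (point y) (¬p∣point y) eq))

      remQuot-injective : ∀ {i j : Fin (3 ℕ.* k)} → remQuot k i ≡ remQuot k j → i ≡ j
      remQuot-injective {i} {j} eq = trans (sym (FP.combine-remQuot {3} k i))
        (trans (cong (uncurry combine) eq) (FP.combine-remQuot {3} k j))

      collision : ⊥
      collision with FP.pigeonhole p<3k (residue ∘ value ∘ remQuot k)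
      ... | i , j , i<j , same-residue =
        FP.<⇒≢ i<j (remQuot-injective (value-injective _ _ (residue-≡⇒≈ _ _ same-residue)))

  nonresidue-product : ∀ {A B} → ¬ p∣ A → ¬ p∣ B → ¬ IsSquare A → ¬ IsSquare B →
                       ¬ ¬ IsSquare (A * B)
  nonresidue-product ¬p∣A ¬p∣B ¬sqA ¬sqB ¬sqAB = Collision.collision ¬p∣A ¬p∣B ¬sqA ¬sqB ¬sqAB

  symbol-mul : ∀ {a b e₁ e₂ e} → Symbol a e₁ → Symbol b e₂ → Symbol (a * b) e → e₁ * e₂ ≡ e
  symbol-mul (inj₁ (refl , p∣a)) _ s = sym (symbol-zero (S.∣m⇒∣m*n _ p∣a) s)
  symbol-mul {a = a} {e₁ = e₁} (inj₂ _) (inj₁ (refl , p∣b)) s =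
    trans (ℤP.*-zeroʳ e₁) (sym (symbol-zero (S.∣n⇒∣m*n a p∣b) s))
  symbol-mul (inj₂ (inj₁ (refl , ¬p∣a , sqa))) (inj₂ (inj₁ (refl , ¬p∣b , sqb))) s =
    sym (symbol-one (¬p∣-* ¬p∣a ¬p∣b) (λ ¬sq → ¬sq (IsSquare-* sqa sqb)) s)
  symbol-mul (inj₂ (inj₁ (refl , ¬p∣a , sqa))) (inj₂ (inj₂ (refl , _ , ¬sqb))) s =
    sym (symbol-minus-one (¬sqb ∘ IsSquare-cancel sqa ¬p∣a) s)
  symbol-mul {a} {b} (inj₂ (inj₂ (refl , _ , ¬sqa))) (inj₂ (inj₁ (refl , ¬p∣b , sqb))) s =
    sym (symbol-minus-one (¬sqa ∘ IsSquare-cancel sqb ¬p∣b ∘ IsSquare-resp-≈ (≡⇒≈ (ℤP.*-comm a b))) s)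
  symbol-mul (inj₂ (inj₂ (refl , ¬p∣a , ¬sqa))) (inj₂ (inj₂ (refl , ¬p∣b , ¬sqb))) s =
    sym (symbol-one (¬p∣-* ¬p∣a ¬p∣b) (nonresidue-product ¬p∣a ¬p∣b ¬sqa ¬sqb) s)

  symbol-common-factor : ∀ {W Z Z̄ e₁ e₂ e₃} → ¬ p∣ W →
    Symbol (W * Z̄) e₁ → Symbol (W * Z) e₂ → Symbol (Z * Z̄) e₃ → e₁ * e₂ ≡ e₃
  symbol-common-factor {W} {Z} {Z̄} ¬p∣W s₁ s₂ s₃ =
    symbol-mul s₁ s₂ (Symbol-resp-≈ (≡⇒≈ regroup) (Symbol-square-factor ¬p∣W s₃))
    where
    regroup : W * W * (Z * Z̄) ≡ W * Z̄ * (W * Z)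
    regroup = solve (W ∷ Z ∷ Z̄ ∷ [])

module Norm (p : ℕ) (p-prime : Prime p) {d : ℤ} (a b : ℤ) (N[w]≡p : N {d} (a + b √) ≡ + p) where
  open Congruence p p-prime

  norm≈0 : a * a ≈ d * (b * b)
  norm≈0 = mk≈ (divides (+ 1) (trans N[w]≡p (sym (ℤP.*-identityˡ (+ p)))))

  -- p does not divide both coordinates, since otherwise p² ∣ N(w) = p.
  ¬p∣both : p∣ a → p∣ b → ⊥
  ¬p∣both (divides qa a≡qa·p) (divides qb b≡qb·p) =
    ¬p∣1 (divides c (ℤP.*-cancelʳ-≡ (+ 1) (c * + p) (+ p) p≡c·p·p))
    where
    c : ℤ
    c = qa * qa - d * (qb * qb)
    factor-p² : ∀ d u v P → (u * P) * (u * P) - d * ((v * P) * (v * P))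
                          ≡ ((u * u - d * (v * v)) * P) * P
    factor-p² = solve-∀
    p≡c·p·p : + 1 * + p ≡ (c * + p) * + p
    p≡c·p·p = begin
      + 1 * + p                                         ≡⟨ ℤP.*-identityˡ (+ p) ⟩
      + p                                               ≡⟨ N[w]≡p ⟨
      a * a - d * (b * b)                               ≡⟨ cong₂ (λ u v → u * u - d * (v * v)) a≡qa·p b≡qb·p ⟩
      (qa * + p) * (qa * + p) - d * ((qb * + p) * (qb * + p)) ≡⟨ factor-p² d qa qb (+ p) ⟩
      (c * + p) * + p                                   ∎
      where open ≡-Reasoning

  -- Hence p ∤ b: otherwise p ∣ d b² ≡ a², so p ∣ a as well.
  ¬p∣b : ¬ p∣ b
  ¬p∣b p∣b = [ absurd , absurd ] (euclid a a p∣a²)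
    where
    absurd : p∣ a → ⊥
    absurd p∣a = ¬p∣both p∣a p∣b
    p∣a² : p∣ (a * a)
    p∣a² = p∣-resp-≈ (≈-sym norm≈0) (S.∣n⇒∣m*n d (S.∣m⇒∣m*n b p∣b))

  -- If also p ∤ d, then p ∤ a, because a² ≡ d b².
  ¬p∣a : ¬ p∣ d → ¬ p∣ a
  ¬p∣a ¬p∣d p∣a = ¬p∣-* ¬p∣d (¬p∣-* ¬p∣b ¬p∣b) (p∣-resp-≈ norm≈0 (S.∣m⇒∣m*n a p∣a))

  root : ∃ λ t → b * t ≈ - a
  root = solve-linear ¬p∣b (- a)

N-conj : ∀ {d} (z : ℤ√ d) → N (conj z) ≡ N z
N-conj {d} (x + y √) = begin
  x * x - d * ((- y) * (- y))  ≡⟨ solve (x ∷ y ∷ d ∷ []) ⟩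
  x * x - d * (y * y)          ∎
  where open ≡-Reasoning

reduce : {d : ℤ} → ℤ → ℤ√ d → ℤ
reduce t α = re α + im α * t

module Reduction (p : ℕ) (p-prime : Prime p) {d : ℤ} (a b : ℤ) (N[w]≡p : N {d} (a + b √) ≡ + p)
                 (t : ℤ) (bt≈-a : Congruence._≈_ p p-prime (b * t) (- a)) where
  open Congruence p p-prime
  open Squares p p-prime
  open LegendreSymbol p p-prime
  open Norm p p-prime {d} a b N[w]≡p using (norm≈0; ¬p∣b)

  w : ℤ√ d
  w = a + b √

  φ : ℤ√ d → ℤ
  φ = reduce t

  conj-root : (- b) * (- t) ≈ - a
  conj-root = begin
    (- b) * (- t)  ≡⟨ solve (b ∷ t ∷ []) ⟩
    b * t          ≈⟨ bt≈-a ⟩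
    - a            ∎
    where open ≈-Reasoning

  -- t is a square root of d:  b²(t² - d) ≡ a² - d b² ≡ 0 and p ∤ b.
  t²≈d : t * t ≈ d
  t²≈d = mk≈ ([ ⊥-elim ∘ ¬p∣-* ¬p∣b ¬p∣b , id ] (euclid (b * b) (t * t - d) (≈0⇒p∣ b²[t²-d]≈0)))
    where
    b²[t²-d]≈0 : b * b * (t * t - d) ≈ + 0
    b²[t²-d]≈0 = begin
      b * b * (t * t - d)              ≡⟨ solve (b ∷ t ∷ d ∷ []) ⟩
      (b * t) * (b * t) - d * (b * b)  ≈⟨ +-cong (*-cong bt≈-a bt≈-a) (≈-refl { - (d * (b * b))}) ⟩
      (- a) * (- a) - d * (b * b)      ≡⟨ solve (a ∷ b ∷ d ∷ []) ⟩
      a * a - d * (b * b)              ≈⟨ p∣⇒≈0 (p∣difference norm≈0) ⟩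
      + 0                              ∎
      where open ≈-Reasoning

  φ-⊗ : ∀ α β → φ (α ⊗ β) ≈ φ α * φ β
  φ-⊗ (x + y √) (x′ + y′ √) = begin
    (x * x′ + d * (y * y′)) + (x * y′ + y * x′) * t
      ≈⟨ +-cong (+-cong (≈-refl {x * x′}) (*-cong (≈-sym t²≈d) (≈-refl {y * y′})))
                (≈-refl {(x * y′ + y * x′) * t}) ⟩
    (x * x′ + t * t * (y * y′)) + (x * y′ + y * x′) * t
      ≡⟨ solve (x ∷ y ∷ x′ ∷ y′ ∷ t ∷ []) ⟩
    (x + y * t) * (x′ + y′ * t) ∎
    where open ≈-Reasoning

  φ-⊖ : ∀ α β → φ (α ⊖ β) ≡ φ α - φ β
  φ-⊖ (x + y √) (x′ + y′ √) = begin
    (x - x′) + (y - y′) * t      ≡⟨ solve (x ∷ y ∷ x′ ∷ y′ ∷ t ∷ []) ⟩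
    (x + y * t) - (x′ + y′ * t)  ∎
    where open ≡-Reasoning

  φ[w]≈0 : φ w ≈ + 0
  φ[w]≈0 = ≈-trans (+-cong (≈-refl {a}) bt≈-a) (≡⇒≈ (ℤP.+-inverseʳ a))

  re-conj≈ : ∀ α → re (conj w ⊗ α) ≈ a * φ α
  re-conj≈ (x + y √) = begin
    a * x + d * ((- b) * y)      ≈⟨ +-cong (≈-refl {a * x}) (*-cong (≈-sym t²≈d) (≈-refl {(- b) * y})) ⟩
    a * x + t * t * ((- b) * y)  ≡⟨ solve (a ∷ x ∷ t ∷ b ∷ y ∷ []) ⟩
    a * x - t * y * (b * t)      ≈⟨ +-cong (≈-refl {a * x}) (neg-cong (*-cong (≈-refl {t * y}) bt≈-a)) ⟩
    a * x - t * y * (- a)        ≡⟨ solve (a ∷ x ∷ t ∷ y ∷ []) ⟩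
    a * (x + y * t)              ∎
    where open ≈-Reasoning

  im-conj≈ : ∀ α → im (conj w ⊗ α) ≈ - (b * φ α)
  im-conj≈ (x + y √) = begin
    a * y + (- b) * x        ≡⟨ solve (a ∷ y ∷ b ∷ x ∷ []) ⟩
    - (b * x + y * (- a))    ≈⟨ neg-cong (+-cong (≈-refl {b * x}) (*-cong (≈-refl {y}) (≈-sym bt≈-a))) ⟩
    - (b * x + y * (b * t))  ≡⟨ solve (b ∷ x ∷ y ∷ t ∷ []) ⟩
    - (b * (x + y * t))      ∎
    where open ≈-Reasoning

  -- If p divides both coordinates of w̄α, then w ∣ α, the quotient being w̄α/p.
  conj-divisible⇒∣√ : ∀ x y → p∣ re (conj w ⊗ (x + y √)) → p∣ im (conj w ⊗ (x + y √)) →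
                      w ∣√ (x + y √)
  conj-divisible⇒∣√ x y (divides qa re≡qa·p) (divides qb im≡qb·p) =
    qa + qb √ , cong₂ _+_√ (cancel-p re-eq) (cancel-p im-eq)
    where
    open ≡-Reasoning
    cancel-p : ∀ {u v} → u * + p ≡ v * + p → u ≡ v
    cancel-p {u} {v} = ℤP.*-cancelʳ-≡ u v (+ p)
    distribute-re : ∀ a b d u v P → (a * u + d * (b * v)) * P ≡ a * (u * P) + d * (b * (v * P))
    distribute-re = solve-∀
    distribute-im : ∀ a b u v P → (a * v + b * u) * P ≡ a * (v * P) + b * (u * P)
    distribute-im = solve-∀
    re-eq : (a * qa + d * (b * qb)) * + p ≡ x * + p
    re-eq = begin
      (a * qa + d * (b * qb)) * + p
        ≡⟨ distribute-re a b d qa qb (+ p) ⟩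
      a * (qa * + p) + d * (b * (qb * + p))
        ≡⟨ cong₂ (λ u v → a * u + d * (b * v)) re≡qa·p im≡qb·p ⟨
      a * (a * x + d * ((- b) * y)) + d * (b * (a * y + (- b) * x))
        ≡⟨ solve (a ∷ b ∷ d ∷ x ∷ y ∷ []) ⟩
      x * (a * a - d * (b * b))
        ≡⟨ cong (x *_) N[w]≡p ⟩
      x * + p ∎
    im-eq : (a * qb + b * qa) * + p ≡ y * + p
    im-eq = begin
      (a * qb + b * qa) * + p
        ≡⟨ distribute-im a b qa qb (+ p) ⟩
      a * (qb * + p) + b * (qa * + p)
        ≡⟨ cong₂ (λ u v → a * u + b * v) im≡qb·p re≡qa·p ⟨
      a * (a * y + (- b) * x) + b * (a * x + d * ((- b) * y))
        ≡⟨ solve (a ∷ b ∷ d ∷ x ∷ y ∷ []) ⟩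
      y * (a * a - d * (b * b))
        ≡⟨ cong (y *_) N[w]≡p ⟩
      y * + p ∎

  ∣√⇒p∣φ : ∀ α → w ∣√ α → p∣ φ α
  ∣√⇒p∣φ _ (q , refl) = ≈0⇒p∣ (begin
    φ (w ⊗ q)    ≈⟨ φ-⊗ w q ⟩
    φ w * φ q    ≈⟨ *-cong φ[w]≈0 (≈-refl {φ q}) ⟩
    + 0 * φ q    ≡⟨ ℤP.*-zeroˡ (φ q) ⟩
    + 0          ∎)
    where open ≈-Reasoning

  p∣φ⇒∣√ : ∀ α → p∣ φ α → w ∣√ α
  p∣φ⇒∣√ (x + y √) p∣φα = conj-divisible⇒∣√ x y
    (p∣-resp-≈ (≈-sym (re-conj≈ α)) (S.∣n⇒∣m*n a p∣φα))
    (p∣-resp-≈ (≈-sym (im-conj≈ α)) (S.∣m⇒∣-m (S.∣n⇒∣m*n b p∣φα)))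
    where
    α : ℤ√ d
    α = x + y √

  square⇒ : ∀ α → SquareMod√ w α → IsSquare (φ α)
  square⇒ α (β , w∣β²-α) = φ β , (begin
    φ β * φ β    ≈⟨ ≈-sym (φ-⊗ β β) ⟩
    φ (β ⊗ β)    ≈⟨ mk≈ (subst p∣_ (φ-⊖ (β ⊗ β) α) (∣√⇒p∣φ _ w∣β²-α)) ⟩
    φ α          ∎)
    where open ≈-Reasoning

  square⇐ : ∀ α → IsSquare (φ α) → SquareMod√ w α
  square⇐ α (c , c²≈φα) =
    β , p∣φ⇒∣√ ((β ⊗ β) ⊖ α) (subst p∣_ (sym (φ-⊖ (β ⊗ β) α)) (p∣difference φβ²≈φα))
    where
    β : ℤ√ d
    β = c + + 0 √
    φβ²≈φα : φ (β ⊗ β) ≈ φ α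
    φβ²≈φα = begin
      φ (β ⊗ β)  ≈⟨ φ-⊗ β β ⟩
      φ β * φ β  ≡⟨ cong₂ _*_ (ℤP.+-identityʳ c) (ℤP.+-identityʳ c) ⟩
      c * c      ≈⟨ c²≈φα ⟩
      φ α        ∎
      where open ≈-Reasoning

  QRSym⇒Symbol : ∀ α {e} → QRSym w α e → Symbol (φ α) e
  QRSym⇒Symbol α (inj₁ (e≡0 , w∣α)) = inj₁ (e≡0 , ∣√⇒p∣φ α w∣α)
  QRSym⇒Symbol α (inj₂ (inj₁ (e≡1 , ¬w∣α , sq))) =
    inj₂ (inj₁ (e≡1 , ¬w∣α ∘ p∣φ⇒∣√ α , square⇒ α sq))
  QRSym⇒Symbol α (inj₂ (inj₂ (e≡-1 , ¬w∣α , ¬sq))) =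
    inj₂ (inj₂ (e≡-1 , ¬w∣α ∘ p∣φ⇒∣√ α , ¬sq ∘ square⇐ α))

  N≈φφ̄ : ∀ z → N z ≈ φ z * φ (conj z)
  N≈φφ̄ (x + y √) = begin
    x * x - d * (y * y)          ≈⟨ +-cong (≈-refl {x * x}) (neg-cong (*-cong (≈-sym t²≈d) (≈-refl {y * y}))) ⟩
    x * x - t * t * (y * y)      ≡⟨ solve (x ∷ y ∷ t ∷ []) ⟩
    (x + y * t) * (x + (- y) * t) ∎
    where open ≈-Reasoning

  φ[w̄]≈2a : φ (conj w) ≈ + 2 * a
  φ[w̄]≈2a = begin
    a + (- b) * t  ≡⟨ solve (a ∷ b ∷ t ∷ []) ⟩
    a - b * t      ≈⟨ +-cong (≈-refl {a}) (neg-cong bt≈-a) ⟩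
    a - - a        ≡⟨ solve (a ∷ []) ⟩
    + 2 * a        ∎
    where open ≈-Reasoning

p≡1[8]⇒p≡2k+1 : ∀ {p} → Prime p → p % 8 ≡ 1 → ∃ λ k → p ≡ suc (k ℕ.+ k) × 2 ℕ.≤ k
p≡1[8]⇒p≡2k+1 {p} p-prime p%8≡1 = decompose (p ℕ./ 8) p≡1+8m
  where
  p≡1+8m : p ≡ 1 ℕ.+ p ℕ./ 8 ℕ.* 8
  p≡1+8m = trans (ℕDM.m≡m%n+[m/n]*n p 8) (cong (ℕ._+ p ℕ./ 8 ℕ.* 8) p%8≡1)
  halve : ∀ m → 1 ℕ.+ m ℕ.* 8 ≡ suc (m ℕ.* 4 ℕ.+ m ℕ.* 4)
  halve = ℕSolver.solve-∀
  decompose : ∀ m → p ≡ 1 ℕ.+ m ℕ.* 8 → ∃ λ k → p ≡ suc (k ℕ.+ k) × 2 ℕ.≤ k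
  decompose zero    p≡1    = ⊥-elim (¬prime[1] (subst Prime p≡1 p-prime))
  decompose (suc m) p≡1+8m = suc m ℕ.* 4 , trans p≡1+8m (halve (suc m)) , ℕ.s≤s (ℕ.s≤s ℕ.z≤n)

module ProductFormula (p : ℕ) (p-prime : Prime p) (k : ℕ) (p≡2k+1 : p ≡ suc (k ℕ.+ k)) (2≤k : 2 ℕ.≤ k)
                      {d₀ : ℤ} (d₀∈[-1,2] : (d₀ ≡ - (+ 1)) ⊎ (d₀ ≡ + 2))
                      (a b : ℤ) (N[w]≡p : N {d₀} (a + b √) ≡ + p)
                      (t : ℤ) (bt≈-a : Congruence._≈_ p p-prime (b * t) (- a)) where
  open Congruence p p-prime
  open LegendreSymbol p p-prime
  open OddPrime p p-prime k p≡2k+1 2≤k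

  w : ℤ√ d₀
  w = a + b √

  module R  = Reduction p p-prime {d₀} a b N[w]≡p t bt≈-a
  module R̄ = Reduction p p-prime {d₀} a (- b) (trans (N-conj w) N[w]≡p) (- t) R.conj-root

  ¬p∣d₀ : ¬ p∣ d₀
  ¬p∣d₀ = [ d₀≡-1⇒¬p∣d₀ , d₀≡2⇒¬p∣d₀ ]′ d₀∈[-1,2]
    where
    d₀≡-1⇒¬p∣d₀ : d₀ ≡ - (+ 1) → ¬ p∣ d₀
    d₀≡-1⇒¬p∣d₀ d₀≡-1 = ¬p∣1 ∘ S.∣m⇒∣-m ∘ subst p∣_ d₀≡-1
    d₀≡2⇒¬p∣d₀ : d₀ ≡ + 2 → ¬ p∣ d₀
    d₀≡2⇒¬p∣d₀ d₀≡2 = ¬p∣2 ∘ subst p∣_ d₀≡2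

  W : ℤ
  W = R.φ (conj w)

  ¬p∣W : ¬ p∣ W
  ¬p∣W = ¬p∣-resp-≈ (≈-sym R.φ[w̄]≈2a) (¬p∣-* ¬p∣2 (Norm.¬p∣a p p-prime {d₀} a b N[w]≡p ¬p∣d₀))

  product-formula : ∀ z {e₁ e₂ e₃} → Gamma w z e₁ → Gamma (conj w) z e₂ → Legendre (N z) p e₃ →
                    e₁ * e₂ ≡ e₃
  product-formula z@(x + y √) {e₁} {e₂} {e₃} γ[w,z] γ[w̄,z] [Nz/p] =
    symbol-common-factor ¬p∣W symbol₁ symbol₂ symbol₃
    where
    Z Z̄ : ℤ
    Z = R.φ z
    Z̄ = R.φ (conj z)

    symbol₁ : Symbol (W * Z̄) e₁
    symbol₁ = Symbol-resp-≈ (R.φ-⊗ (conj w) (conj z)) (R.QRSym⇒Symbol _ γ[w,z])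

    -- reducing w z̄ at -t gives W Z
    symbol₂ : Symbol (W * Z) e₂
    symbol₂ = Symbol-resp-≈ reduce-at-−t (R̄.QRSym⇒Symbol _ γ[w̄,z])
      where
      reduce-at-−t : R̄.φ (conj (a + (- b) √) ⊗ conj z) ≈ W * Z
      reduce-at-−t = begin
        R̄.φ (conj (a + (- b) √) ⊗ conj z)      ≈⟨ R̄.φ-⊗ (conj (a + (- b) √)) (conj z) ⟩
        (a + (- (- b)) * (- t)) * (x + (- y) * (- t))  ≡⟨ solve (a ∷ b ∷ x ∷ y ∷ t ∷ []) ⟩
        (a + (- b) * t) * (x + y * t)                  ∎
        where open ≈-Reasoning

    symbol₃ : Symbol (Z * Z̄) e₃
    symbol₃ = Symbol-resp-≈ (R.N≈φφ̄ z) (Legendre⇒Symbol [Nz/p])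

lemma4p5 : (d₀ : ℤ) → (d₀ ≡ - (+ 1)) ⊎ (d₀ ≡ + 2) →
           (p : ℕ) → Prime p → p % 8 ≡ 1 →
           (w : ℤ√ d₀) → N w ≡ + p →
           (z : ℤ√ d₀) →
           (e₁ e₂ e₃ : ℤ) →
           Gamma w z e₁ → Gamma (conj w) z e₂ → Legendre (N z) p e₃ →
           e₁ * e₂ ≡ e₃
lemma4p5 d₀ d₀∈[-1,2] p p-prime p%8≡1 (a + b √) N[w]≡p z e₁ e₂ e₃ =
  let k , p≡2k+1 , 2≤k = p≡1[8]⇒p≡2k+1 p-prime p%8≡1
      t , bt≈-a        = Norm.root p p-prime {d₀} a b N[w]≡p
  in  ProductFormula.product-formula p p-prime k p≡2k+1 2≤k d₀∈[-1,2] a b N[w]≡p t bt≈-a z
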